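{- If $K$ is a base term, then for every term $M$, $(\widetilde M)~K\to^{*}_{a\cup\beta}M:K$.
   Context: Fix a ring of scalars (elements $\alpha,\beta$). Terms: $M,N,L ::= V \mid (M)~N \mid \alpha.M \mid M+N$; values $V,W ::= 0 \mid B \mid \alpha.V \mid V+W$; base terms $B ::= x \mid \lambda x\,M$. $M[x:=N]$ is capture-avoiding substitution. Rewrite rules: $(\beta_n)$ $(\lambda x\,M)~N\to M[x:=N]$. $(A)$ $(M+N)~L\to (M)~L+(N)~L$; $(\alpha.M)~N\to\alpha.(M)~N$; $(0)~M\to 0$. (Asso) $M+(N+L)\to(M+N)+L$ and $(M+N)+L\to M+(N+L)$. (Com) $M+N\to N+M$. $(F)$ $\alpha.M+\beta.M\to(\alpha+\beta).M$; $\alpha.M+M\to(\alpha+1).M$; $M+M\to(1+1).M$; $\alpha.(\beta.M)\to(\alpha\beta).M$. $(S)$ $\alpha.(M+N)\to\alpha.M+\alpha.N$; $1.M\to M$; $0.M\to 0$; $\alpha.0\to 0$; $0+M\to M$. Context rules $(\xi)$: from $M\to M'$ infer $(M)~N\to(M')~N$, $M+N\to M'+N$, $N+M\to N+M'$, $\alpha.M\to\alpha.M'$. $\to_a$ is generated by $A\cup\mathrm{Asso}\cup\mathrm{Com}\cup F\cup S$ closed under $\xi$; $\to_{\beta_n}$ by $\beta_n$ closed under $\xi$; $\to_{a\cup\beta}:=\to_a\cup\to_{\beta_n}$; $R^{*}$ is reflexive-transitive closure. Translation (with $f,g,h$ fresh): $\widetilde{x}=\lambda f\,(f)~x$; $\widetilde{0}=0$;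 $\widetilde{\lambda x\,M}=\lambda f\,(f)~\lambda x\,\widetilde{M}$; $\widetilde{(M)~N}=\lambda f\,(\widetilde M)~\lambda g\,(\widetilde N)~\lambda h\,((g)~h)~f$; $\widetilde{\alpha.M}=\lambda f\,(\alpha.\widetilde M)~f$; $\widetilde{M+N}=\lambda f\,(\widetilde M+\widetilde N)~f$; $\Psi(x)=x$, $\Psi(0)=0$, $\Psi(\lambda x\,M)=\lambda x\,\widetilde M$, $\Psi(\alpha.V)=\alpha.\Psi(V)$, $\Psi(V+W)=\Psi(V)+\Psi(W)$. The binary operation $M:K$ (with $B$ a base term) is defined by: $0:K=0$; $B:K=(K)~\Psi(B)$; $\alpha.M:K=\alpha.(M:K)$; $M+N:K=(M:K)+(N:K)$; $(0)~N:K=0$; $(B)~N:K=N:\lambda f\,((\Psi(B))~f)~K$; $(\alpha.M)~N:K=(\alpha.((M)~N)):K$; $(M+N)~L:K=((M)~L+(N)~L):K$; $((M)~N)~L:K=(M)~N:\lambda g\,(\widetilde L)~\lambda h\,((g)~h)~K$. -}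

module Defs where

open import Level using (Level)
open import Data.Nat using (ℕ; zero; suc)
open import Data.Sum using (_⊎_)
open import Algebra.Bundles using (Ring)
open import Relation.Binary.Construct.Closure.ReflexiveTransitive using (Star)

-- Terms use de Bruijn indices (variable 0 = innermost binder), so that
-- α-equivalence is built in and "fresh variables f, g, h" become binders
-- under which the surrounding terms are shifted.
module Lambda {c ℓ : Level} (R : Ring c ℓ) where

  open Ring R using (Carrier; 0#; 1#) renaming (_+_ to _+ᵣ_; _*_ to _*ᵣ_)

  infixl 6 _⊕_
  infixr 7 _·_

  data Term : Set c where
    var : ℕ → Term
    lam : Term → Term
    𝟘   : Term
    app : Term → Term → Term
    _·_ : Carrier → Term → Term
    _⊕_ : Term → Term → Term

  data Base : Term → Set c where
    b-var : ∀ {x} → Base (var x)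
    b-lam : ∀ {M} → Base (lam M)

  data Value : Term → Set c where
    v-zero : Value 𝟘
    v-base : ∀ {B} → Base B → Value B
    v-scal : ∀ {α V} → Value V → Value (α · V)
    v-plus : ∀ {V W} → Value V → Value W → Value (V ⊕ W)

  ext : (ℕ → ℕ) → ℕ → ℕ
  ext ρ zero    = zero
  ext ρ (suc n) = suc (ρ n)

  rename : (ℕ → ℕ) → Term → Term
  rename ρ (var x)   = var (ρ x)
  rename ρ (lam M)   = lam (rename (ext ρ) M)
  rename ρ 𝟘         = 𝟘
  rename ρ (app M N) = app (rename ρ M) (rename ρ N)
  rename ρ (α · M)   = α · rename ρ M
  rename ρ (M ⊕ N)   = rename ρ M ⊕ rename ρ N

  ↑ : Term → Term
  ↑ = rename suc

  exts : (ℕ → Term) → ℕ → Term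
  exts σ zero    = var zero
  exts σ (suc n) = ↑ (σ n)

  subst : (ℕ → Term) → Term → Term
  subst σ (var x)   = σ x
  subst σ (lam M)   = lam (subst (exts σ) M)
  subst σ 𝟘         = 𝟘
  subst σ (app M N) = app (subst σ M) (subst σ N)
  subst σ (α · M)   = α · subst σ M
  subst σ (M ⊕ N)   = subst σ M ⊕ subst σ N

  σ₀ : Term → ℕ → Term
  σ₀ N zero    = N
  σ₀ N (suc n) = var n

  _[_] : Term → Term → Term
  M [ N ] = subst (σ₀ N) M

  data Ax : Term → Term → Set c where
    A-plus  : ∀ {M N L} → Ax (app (M ⊕ N) L) (app M L ⊕ app N L)
    A-scal  : ∀ {α M N} → Ax (app (α · M) N) (α · app M N)
    A-zero  : ∀ {M} → Ax (app 𝟘 M) 𝟘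
    Asso-l  : ∀ {M N L} → Ax (M ⊕ (N ⊕ L)) ((M ⊕ N) ⊕ L)
    Asso-r  : ∀ {M N L} → Ax ((M ⊕ N) ⊕ L) (M ⊕ (N ⊕ L))
    Com     : ∀ {M N} → Ax (M ⊕ N) (N ⊕ M)
    F-ab    : ∀ {α β M} → Ax (α · M ⊕ β · M) ((α +ᵣ β) · M)
    F-a1    : ∀ {α M} → Ax (α · M ⊕ M) ((α +ᵣ 1#) · M)
    F-11    : ∀ {M} → Ax (M ⊕ M) ((1# +ᵣ 1#) · M)
    F-mul   : ∀ {α β M} → Ax (α · (β · M)) ((α *ᵣ β) · M)
    S-dist  : ∀ {α M N} → Ax (α · (M ⊕ N)) (α · M ⊕ α · N)
    S-one   : ∀ {M} → Ax (1# · M) M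
    S-zero  : ∀ {M} → Ax (0# · M) 𝟘
    S-zero' : ∀ {α} → Ax (α · 𝟘) 𝟘
    S-plus0 : ∀ {M} → Ax (𝟘 ⊕ M) M

  data Beta : Term → Term → Set c where
    beta : ∀ {M N} → Beta (app (lam M) N) (M [ N ])

  data Ctx (Rel : Term → Term → Set c) : Term → Term → Set c where
    root  : ∀ {M M'} → Rel M M' → Ctx Rel M M'
    appL  : ∀ {M M' N} → Ctx Rel M M' → Ctx Rel (app M N) (app M' N)
    plusL : ∀ {M M' N} → Ctx Rel M M' → Ctx Rel (M ⊕ N) (M' ⊕ N)
    plusR : ∀ {M M' N} → Ctx Rel M M' → Ctx Rel (N ⊕ M) (N ⊕ M')
    scal  : ∀ {α M M'} → Ctx Rel M M' → Ctx Rel (α · M) (α · M')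

  _→a_ : Term → Term → Set c
  _→a_ = Ctx Ax

  _→βn_ : Term → Term → Set c
  _→βn_ = Ctx Beta

  _→aβ_ : Term → Term → Set c
  M →aβ N = M →a N ⊎ M →βn N

  _→aβ*_ : Term → Term → Set c
  _→aβ*_ = Star _→aβ_

  -- The translation M ↦ M̃  (fresh f, g, h become de Bruijn binders)

  ~_ : Term → Term
  -- x̃ = λf (f) x
  ~ var x     = lam (app (var 0) (var (suc x)))
  ~ 𝟘         = 𝟘
  -- (λx M)~ = λf (f) λx M̃
  ~ lam M     = lam (app (var 0) (↑ (lam (~ M))))
  -- ((M) N)~ = λf (M̃) λg (Ñ) λh ((g) h) f
  ~ app M N   = lam (app (↑ (~ M))
                    (lam (app (↑ (↑ (~ N)))
                         (lam (app (app (var 1) (var 0)) (var 2))))))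
  -- (α.M)~ = λf (α.M̃) f
  ~ (α · M)   = lam (app (α · ↑ (~ M)) (var 0))
  -- (M+N)~ = λf (M̃ + Ñ) f
  ~ (M ⊕ N)   = lam (app (↑ (~ M) ⊕ ↑ (~ N)) (var 0))

  Ψ : ∀ {V} → Value V → Term
  Ψ v-zero              = 𝟘
  Ψ (v-base (b-var {x})) = var x
  Ψ (v-base (b-lam {M})) = lam (~ M)
  Ψ (v-scal {α} v)      = α · Ψ v
  Ψ (v-plus v w)        = Ψ v ⊕ Ψ w

  -- (M) N : K is computed by an auxiliary function  capp M c t K,
  -- where c = (N :_) and t = Ñ are the only two ways the argument N is
  -- used by the defining clauses.  This makes the definition structurally
  -- recursive; clause by clause it is the paper's definition.

  -- λf ((Ψ(B)) f) K   (K shifted under the fresh binder f)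
  baseK : ∀ {B} → Base B → Term → Term
  baseK b K = lam (app (app (↑ (Ψ (v-base b))) (var 0)) (↑ K))

  -- λg (L̃) λh ((g) h) K   where t = L̃
  appK : Term → Term → Term
  appK t K = lam (app (↑ t) (lam (app (app (var 1) (var 0)) (↑ (↑ K)))))

  mutual
    infix 5 _∶_
    _∶_ : Term → Term → Term
    𝟘 ∶ K         = 𝟘
    var x ∶ K     = app K (Ψ (v-base (b-var {x})))
    lam M ∶ K     = app K (Ψ (v-base (b-lam {M})))
    (α · M) ∶ K   = α · (M ∶ K)
    (M ⊕ N) ∶ K   = (M ∶ K) ⊕ (N ∶ K)
    app M N ∶ K   = capp M (_∶_ N) (~ N) K

    capp : Term → (Term → Term) → Term → Term → Term
    capp 𝟘 c t K         = 𝟘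
    capp (var x) c t K   = c (baseK (b-var {x}) K)
    capp (lam M) c t K   = c (baseK (b-lam {M}) K)
    capp (α · M) c t K   = α · capp M c t K
    capp (M ⊕ N) c t K   = capp M c t K ⊕ capp N c t K
    -- ((M) N) L : K = (M) N : λg (L̃) λh ((g) h) K
    capp (app M N) c t K = capp M (_∶_ N) (~ N) (appK t K)

module Submission where

open import Defs
open import Algebra.Bundles using (Ring)
open import Data.Nat using (zero; suc)
open import Data.Sum using (inj₁; inj₂)
open import Relation.Binary.PropositionalEquality using (_≡_; refl; cong; cong₂; trans; module ≡-Reasoning)
open import Relation.Binary.Construct.Closure.ReflexiveTransitive
  using (ε; _◅_; _◅◅_; gmap)

-- One β-step turns (M̃) K into the body of M̃
-- with its continuation variable f replaced by K; for a sum or a scalar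
-- multiple the A-rules then distribute K inside and the induction hypothesis
-- applies.  For an application (M) N the β-step leaves (M̃) K' with the
-- continuation K' = λg (Ñ) λh ((g) h) K; by induction this reaches M : K',
-- and each base term B reached there is fed to K', which after one more
-- β-step runs (Ñ) λf ((Ψ(B)) f) K, again covered by induction.

module Simulation {c ℓ} (R : Ring c ℓ) where
  open Lambda R

  subst-rename : ∀ σ ρ τ → (∀ x → σ (ρ x) ≡ τ x) →
                 ∀ t → subst σ (rename ρ t) ≡ subst τ t
  subst-rename σ ρ τ h (var x)   = h x
  subst-rename σ ρ τ h (lam t)   = cong lam (subst-rename (exts σ) (ext ρ) (exts τ) h′ t)
    where
    h′ : ∀ x → exts σ (ext ρ x) ≡ exts τ x
    h′ zero    = refl
    h′ (suc n) = cong ↑ (h n)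
  subst-rename σ ρ τ h 𝟘         = refl
  subst-rename σ ρ τ h (app t u) = cong₂ app (subst-rename σ ρ τ h t) (subst-rename σ ρ τ h u)
  subst-rename σ ρ τ h (α · t)   = cong (α ·_) (subst-rename σ ρ τ h t)
  subst-rename σ ρ τ h (t ⊕ u)   = cong₂ _⊕_ (subst-rename σ ρ τ h t) (subst-rename σ ρ τ h u)

  subst-var≡rename : ∀ σ ρ → (∀ x → σ x ≡ var (ρ x)) → ∀ t → subst σ t ≡ rename ρ t
  subst-var≡rename σ ρ h (var x)   = h x
  subst-var≡rename σ ρ h (lam t)   = cong lam (subst-var≡rename (exts σ) (ext ρ) h′ t)
    where
    h′ : ∀ x → exts σ x ≡ var (ext ρ x)
    h′ zero    = refl
    h′ (suc n) = cong ↑ (h n)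
  subst-var≡rename σ ρ h 𝟘         = refl
  subst-var≡rename σ ρ h (app t u) = cong₂ app (subst-var≡rename σ ρ h t) (subst-var≡rename σ ρ h u)
  subst-var≡rename σ ρ h (α · t)   = cong (α ·_) (subst-var≡rename σ ρ h t)
  subst-var≡rename σ ρ h (t ⊕ u)   = cong₂ _⊕_ (subst-var≡rename σ ρ h t) (subst-var≡rename σ ρ h u)

  rename-id : ∀ ρ → (∀ x → ρ x ≡ x) → ∀ t → rename ρ t ≡ t
  rename-id ρ h (var x)   = cong var (h x)
  rename-id ρ h (lam t)   = cong lam (rename-id (ext ρ) h′ t)
    where
    h′ : ∀ x → ext ρ x ≡ x
    h′ zero    = refl
    h′ (suc n) = cong suc (h n)
  rename-id ρ h 𝟘         = refl
  rename-id ρ h (app t u) = cong₂ app (rename-id ρ h t) (rename-id ρ h u)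
  rename-id ρ h (α · t)   = cong (α ·_) (rename-id ρ h t)
  rename-id ρ h (t ⊕ u)   = cong₂ _⊕_ (rename-id ρ h t) (rename-id ρ h u)

  subst-id : ∀ t → subst var t ≡ t
  subst-id t = trans (subst-var≡rename var (λ x → x) (λ _ → refl) t) (rename-id _ (λ _ → refl) t)

  ↑-[] : ∀ N t → ↑ t [ N ] ≡ t
  ↑-[] N t = trans (subst-rename (σ₀ N) suc var (λ _ → refl) t) (subst-id t)

  exts-↑↑-[] : ∀ N t → subst (exts (σ₀ N)) (↑ (↑ t)) ≡ ↑ t
  exts-↑↑-[] N t = begin
    subst (exts (σ₀ N)) (↑ (↑ t))     ≡⟨ subst-rename (exts (σ₀ N)) suc (λ x → ↑ (σ₀ N x)) (λ _ → refl) (↑ t) ⟩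
    subst (λ x → ↑ (σ₀ N x)) (↑ t)    ≡⟨ subst-rename (λ x → ↑ (σ₀ N x)) suc (λ x → var (suc x)) (λ _ → refl) t ⟩
    subst (λ x → var (suc x)) t       ≡⟨ subst-var≡rename _ suc (λ _ → refl) t ⟩
    ↑ t                               ∎
    where open ≡-Reasoning

  lift* : (f : Term → Term) →
          (∀ {M M′} → M →a M′ → f M →a f M′) →
          (∀ {M M′} → M →βn M′ → f M →βn f M′) →
          ∀ {M M′} → M →aβ* M′ → f M →aβ* f M′
  lift* f fa fβ = gmap f step
    where
    step : ∀ {M M′} → M →aβ M′ → f M →aβ f M′
    step (inj₁ s) = inj₁ (fa s)
    step (inj₂ s) = inj₂ (fβ s)

  ·-cong* : ∀ α {M M′} → M →aβ* M′ → (α · M) →aβ* (α · M′)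
  ·-cong* α = lift* (α ·_) scal scal

  ⊕-cong* : ∀ {M M′ N N′} → M →aβ* M′ → N →aβ* N′ → (M ⊕ N) →aβ* (M′ ⊕ N′)
  ⊕-cong* {N = N} p q = lift* (_⊕ N) plusL plusL p ◅◅ lift* (_ ⊕_) plusR plusR q

  β* : ∀ {M N P} → M [ N ] ≡ P → app (lam M) N →aβ* P
  β* refl = inj₂ (root beta) ◅ ε

  ax* : ∀ {M N} → Ax M N → M →aβ* N
  ax* s = inj₁ (root s) ◅ ε

  appK-β : ∀ t K {B} (b : Base B) → app (appK t K) (Ψ (v-base b)) →aβ* app t (baseK b K)
  appK-β t K b = β* (cong₂ app (↑-[] _ t) (cong (λ u → lam (app _ u)) (exts-↑↑-[] _ K)))

  Simulates : Term → Set c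
  Simulates N = ∀ K → app (~ N) K →aβ* (N ∶ K)

  ∶-appK : ∀ {N} → Simulates N → ∀ M K → (M ∶ appK (~ N) K) →aβ* capp M (N ∶_) (~ N) K
  ∶-appK sim 𝟘         K = ε
  ∶-appK sim (var x)   K = appK-β _ K b-var ◅◅ sim (baseK b-var K)
  ∶-appK sim (lam M)   K = appK-β _ K b-lam ◅◅ sim (baseK b-lam K)
  ∶-appK sim (α · M)   K = ·-cong* α (∶-appK sim M K)
  ∶-appK sim (M ⊕ M′)  K = ⊕-cong* (∶-appK sim M K) (∶-appK sim M′ K)
  ∶-appK sim (app M N) K = ε

  simulation : ∀ M → Simulates M
  simulation (var x)   K = β* refl
  simulation (lam M)   K = β* (cong (app K) (↑-[] K (lam (~ M))))
  simulation 𝟘         K = ax* A-zero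
  simulation (app M N) K =
    β* (cong₂ app (↑-[] K (~ M)) (cong (λ u → lam (app u _)) (exts-↑↑-[] K (~ N))))
    ◅◅ simulation M (appK (~ N) K)
    ◅◅ ∶-appK (simulation N) M K
  simulation (α · M)   K =
    β* (cong (λ u → app (α · u) K) (↑-[] K (~ M)))
    ◅◅ ax* A-scal
    ◅◅ ·-cong* α (simulation M K)
  simulation (M ⊕ N)   K =
    β* (cong (λ u → app u K) (cong₂ _⊕_ (↑-[] K (~ M)) (↑-[] K (~ N))))
    ◅◅ ax* A-plus
    ◅◅ ⊕-cong* (simulation M K) (simulation N K)

-- With call-by-name β the simulation holds for every continuation K.
lemma4 : ∀ {c ℓ} (R : Ring c ℓ) → let open Lambda R in
    (K : Term) → Base K → (M : Term) → app (~ M) K →aβ* (M ∶ K)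
lemma4 R K _ M = Simulation.simulation R M K
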